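{- Let $Q=T[H_1,\dots,H_t]$ be a strong semicomplete composition. Then there is an arc (in at least one direction) between every 3-king of $Q$ and every non-king of $Q$; moreover, for every non-king $u$ of $Q$ there exists a 3-king $v$ of $Q$ such that $d_Q(u,v)>3$ and $v$ dominates $u$ (i.e. $vu\in A(Q)$).
   Context: All digraphs are finite, without loops or parallel arcs; paths are directed; $d_Q(x,y)$ is the length of a shortest directed $x$–$y$ path (infinite if none). Let $T$ be a digraph with vertices $u_1,\dots,u_t$ ($t\ge 2$) and $H_1,\dots,H_t$ digraphs, $H_i$ having vertices $u_{i,j}$, $1\le j\le n_i$. The composition $Q=T[H_1,\dots,H_t]$ has vertex set $\{u_{i,j}\}$ and arc set $\bigcup_i A(H_i)\cup\{u_{i,j}u_{p,q}: u_iu_p\in A(T)\}$ (all $j,q$). It is a semicomplete composition if $T$ is semicomplete (at least one arc between every two distinct vertices). A digraph is strong if every vertex can reach every other vertex. A 3-king is a vertex from which every other vertex can be reached by a directed path of length at most 3; a non-king is a vertex which is not a 3-king. -}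

module Defs where

open import Data.Nat using (ℕ; zero; suc; _≤_)
open import Data.Fin using (Fin)
open import Data.Product using (Σ; _×_; _,_)
open import Data.Sum using (_⊎_)
open import Relation.Nullary using (¬_; Dec)
open import Relation.Binary.PropositionalEquality using (_≡_; _≢_)

record Digraph (V : Set) : Set₁ where
  field
    Arc      : V → V → Set
    arc?     : (x y : V) → Dec (Arc x y)
    loopless : (x : V) → ¬ Arc x x
open Digraph public

-- directed walks of length k (a shortest walk is a path, so distances agree)
data Walk {V : Set} (D : Digraph V) : V → V → ℕ → Set where
  here : ∀ {x} → Walk D x x zero
  step : ∀ {x y z k} → Arc D x y → Walk D y z k → Walk D x z (suc k)

DistLe : {V : Set} → Digraph V → ℕ → V → V → Set
DistLe D k x y = Σ ℕ λ l → l ≤ k × Walk D x y l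

Reaches : {V : Set} → Digraph V → V → V → Set
Reaches D x y = Σ ℕ λ l → Walk D x y l

Strong : {V : Set} → Digraph V → Set
Strong D = ∀ x y → Reaches D x y

Semicomplete : {V : Set} → Digraph V → Set
Semicomplete D = ∀ x y → x ≢ y → Arc D x y ⊎ Arc D y x

King3 : {V : Set} → Digraph V → V → Set
King3 D x = ∀ y → y ≢ x → DistLe D 3 x y

NonKing : {V : Set} → Digraph V → V → Set
NonKing D x = ¬ King3 D x

CVert : (t : ℕ) → (Fin t → ℕ) → Set
CVert t n = Σ (Fin t) λ i → Fin (n i)

data CompArc {t : ℕ} {n : Fin t → ℕ} (T : Digraph (Fin t))
             (H : (i : Fin t) → Digraph (Fin (n i))) : CVert t n → CVert t n → Set where
  inner : ∀ {i j q} → Arc (H i) j q → CompArc T H (i , j) (i , q)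
  outer : ∀ {i p j q} → Arc T i p → CompArc T H (i , j) (p , q)

open import Data.Fin.Properties using () renaming (_≟_ to _≟F_)
open import Relation.Nullary using (yes; no)
open import Relation.Binary.PropositionalEquality using (refl)
open import Data.Product using (proj₁)

private
  compArc? : {t : ℕ} {n : Fin t → ℕ} (T : Digraph (Fin t))
             (H : (i : Fin t) → Digraph (Fin (n i))) →
             (x y : CVert t n) → Dec (CompArc T H x y)
  compArc? T H (i , j) (p , q) with arc? T i p
  ... | yes a = yes (outer a)
  ... | no na with i ≟F p
  ...   | no i≢p = no λ { (inner _) → i≢p refl ; (outer a) → na a }
  ...   | yes refl with arc? (H i) j q
  ...     | yes h = yes (inner h)
  ...     | no nh = no λ { (inner h) → nh h ; (outer a) → na a }

  compLoopless : {t : ℕ} {n : Fin t → ℕ} (T : Digraph (Fin t))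
                 (H : (i : Fin t) → Digraph (Fin (n i))) →
                 (x : CVert t n) → ¬ CompArc T H x x
  compLoopless T H (i , j) (inner h) = loopless (H i) j h
  compLoopless T H (i , j) (outer a) = loopless T i a

Composition : {t : ℕ} {n : Fin t → ℕ} (T : Digraph (Fin t))
              (H : (i : Fin t) → Digraph (Fin (n i))) → Digraph (CVert t n)
Composition T H = record
  { Arc = CompArc T H ; arc? = compArc? T H ; loopless = compLoopless T H }

module Submission where

-- Proof outline.  Write Q = T[H₁,…,H_t] and let "Within T k x y" mean that
-- y is reachable from x in T by a walk of length at most k.
--
-- Facts about a semicomplete digraph T on Fin t:
--   * if y is out of 3-reach of i, then y dominates everything within 2 of
--     i, hence y reaches within 2 steps everything within 3 of i;
--   * every nonempty vertex set S has a member reaching all of S in ≤ 2 steps;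
--   * consequently a vertex i that is not a 3-king is dominated by a 3-king
--     k lying out of 3-reach of i (take k a 2-king of {y | ¬ Within T 3 i y});
--   * if T is strong with t ≥ 2, every vertex lies on a 2- or 3-cycle.
-- Facts about the composition: Q-walks project to T-walks that are no
-- longer; T-walks of positive length lift to Q-walks between any chosen
-- vertices of the end blocks; with the short cycles, (i , a) is a 3-king of
-- Q exactly when i is a 3-king of T.  Both halves of the theorem then
-- reduce to the statements about T, since Q is strong only if T is.

open import Defs
open import Data.Nat using (ℕ; zero; suc; _≤_; z≤n; s≤s)
open import Data.Nat.Properties using (m≤n⇒m≤1+n; ≤-refl; ≤-trans)
open import Data.Fin using (Fin; zero; suc; fromℕ<)
open import Data.Fin.Properties using (_≟_; any?; ¬∀⟶∃¬)
open import Data.Product using (Σ; _×_; _,_; proj₁; proj₂)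
open import Data.Sum using (_⊎_; inj₁; inj₂)
import Data.Sum as Sum
open import Data.Empty using (⊥-elim)
open import Data.List using (List; []; _∷_; filter; allFin)
open import Data.List.Membership.Propositional using (_∈_)
open import Data.List.Membership.Propositional.Properties
  using (∈-filter⁺; ∈-filter⁻; ∈-allFin)
open import Data.List.Relation.Unary.Any using (here; there)
open import Relation.Nullary using (¬_; Dec; yes; no)
open import Relation.Nullary.Decidable using (_×-dec_; _⊎-dec_; ¬?)
open import Relation.Binary.PropositionalEquality using (_≡_; _≢_; refl; cong)

_▷_ : {V : Set} {D : Digraph V} {x y z : V} {l : ℕ} →
      Walk D x y l → Arc D y z → Walk D x z (suc l)
here     ▷ a = step a here
step b w ▷ a = step b (w ▷ a)

-- Reachability within k steps, built by appending arcs; this is the form in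
-- which the domination arguments below are phrased.
Within : {V : Set} → Digraph V → ℕ → V → V → Set
Within D zero    x y = x ≡ y
Within {V} D (suc k) x y = Within D k x y ⊎ Σ V λ z → Within D k x z × Arc D z y

within-refl : {V : Set} (D : Digraph V) (k : ℕ) {x : V} → Within D k x x
within-refl D zero    = refl
within-refl D (suc k) = inj₁ (within-refl D k)

arc⇒within : {V : Set} (D : Digraph V) {k : ℕ} {x y : V} →
             Arc D x y → Within D (suc k) x y
arc⇒within D {k} a = inj₂ (_ , within-refl D k , a)

-- Prepending an arc, needed to read a walk (built from the front) as Within.
arc-within : {V : Set} {D : Digraph V} (k : ℕ) {x y z : V} →
             Arc D x y → Within D k y z → Within D (suc k) x z
arc-within {D = D} zero a refl           = arc⇒within D a
arc-within (suc k) a (inj₁ w)             = inj₁ (arc-within k a w)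
arc-within (suc k) a (inj₂ (z , w , zy))  = inj₂ (z , arc-within k a w , zy)

distLe⇒within : {V : Set} {D : Digraph V} (k : ℕ) {x y : V} →
                DistLe D k x y → Within D k x y
distLe⇒within {D = D} k (_ , _ , here)      = within-refl D k
distLe⇒within (suc k) (suc l , s≤s l≤k , step a w) = arc-within k a (distLe⇒within k (l , l≤k , w))

within⇒distLe : {V : Set} {D : Digraph V} (k : ℕ) {x y : V} →
                Within D k x y → DistLe D k x y
within⇒distLe zero    refl = 0 , z≤n , here
within⇒distLe (suc k) (inj₁ w) with within⇒distLe k w
... | l , l≤k , walk = l , m≤n⇒m≤1+n l≤k , walk
within⇒distLe (suc k) (inj₂ (_ , w , a)) with within⇒distLe k w
... | l , l≤k , walk = suc l , s≤s l≤k , walk ▷ a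

ShortCycle : {V : Set} → Digraph V → V → Set
ShortCycle D i = Σ ℕ λ l → suc l ≤ 3 × Walk D i i (suc l)

another : {s : ℕ} → 2 ≤ s → (i : Fin s) → Σ (Fin s) λ p → p ≢ i
another (s≤s (s≤s _)) zero    = suc zero , λ ()
another (s≤s (s≤s _)) (suc _) = zero , λ ()

module Semicomplete-Facts {t : ℕ} (T : Digraph (Fin t)) (sc : Semicomplete T) where

  within? : (k : ℕ) (x y : Fin t) → Dec (Within T k x y)
  within? zero    x y = x ≟ y
  within? (suc k) x y = within? k x y ⊎-dec any? (λ z → within? k x z ×-dec arc? T z y)

  within⇒king : {i : Fin t} → ((y : Fin t) → Within T 3 i y) → King3 T i
  within⇒king reach y _ = within⇒distLe 3 (reach y)

  dominates : {m : ℕ} {i x z : Fin t} →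
              ¬ Within T (suc m) i x → Within T m i z → Arc T x z
  dominates {x = x} {z} x-far z-near with sc x z (λ { refl → x-far (inj₁ z-near) })
  ... | inj₁ xz = xz
  ... | inj₂ zx = ⊥-elim (x-far (inj₂ (z , z-near , zx)))

  far⇒reaches : {m : ℕ} {i x y : Fin t} →
                ¬ Within T (suc m) i x → Within T (suc m) i y → Within T 2 x y
  far⇒reaches x-far (inj₁ y-near)         = arc⇒within T (dominates x-far y-near)
  far⇒reaches x-far (inj₂ (z , z-near , zy)) = inj₂ (z , arc⇒within T (dominates x-far z-near) , zy)

  KingOf : List (Fin t) → Fin t → Set
  KingOf L k = (y : Fin t) → y ∈ L → Within T 2 k y

  -- Adding x to L: either the old king still reaches x, or x is out of its
  -- 2-reach and then x reaches everything the old king did.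
  extendKing : (x : Fin t) {L : List (Fin t)} {k : Fin t} → k ∈ L → KingOf L k →
               Σ (Fin t) λ k′ → k′ ∈ x ∷ L × KingOf (x ∷ L) k′
  extendKing x {k = k} k∈L kk with within? 2 k x
  ... | yes k→x = k , there k∈L , λ { y (here refl) → k→x ; y (there y∈L) → kk y y∈L }
  ... | no x-far = x , here refl ,
          λ { y (here refl) → within-refl T 2 ; y (there y∈L) → far⇒reaches x-far (kk y y∈L) }

  twoKing : {p : Fin t} (L : List (Fin t)) → p ∈ L →
            Σ (Fin t) λ k → k ∈ L × KingOf L k
  twoKing (x ∷ [])     _ = x , here refl , λ { y (here refl) → within-refl T 2 }
  twoKing (x ∷ x′ ∷ L) _ with twoKing (x′ ∷ L) (here refl)
  ... | k , k∈L , kk = extendKing x k∈L kk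

  far? : (i y : Fin t) → Dec (¬ Within T 3 i y)
  far? i y = ¬? (within? 3 i y)

  -- A non-3-king i is dominated by a vertex out of its 3-reach which reaches
  -- every vertex in at most two steps: a 2-king k of the vertices far from i
  -- also dominates all vertices within 2 of i.
  escapingKing : {i p : Fin t} → ¬ Within T 3 i p →
                 Σ (Fin t) λ k → ¬ Within T 3 i k × Arc T k i × ((y : Fin t) → Within T 2 k y)
  escapingKing {i} {p} p-far
    with twoKing (filter (far? i) (allFin t)) (∈-filter⁺ (far? i) (∈-allFin p) p-far)
  ... | k , k∈far , kk = k , k-far , dominates k-far (within-refl T 2) , reach
    where
    k-far : ¬ Within T 3 i k
    k-far = proj₂ (∈-filter⁻ (far? i) {xs = allFin t} k∈far)
    reach : (y : Fin t) → Within T 2 k y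
    reach y with within? 3 i y
    ... | yes y-near = far⇒reaches k-far y-near
    ... | no y-far   = kk y (∈-filter⁺ (far? i) (∈-allFin y) y-far)

  dominatingKing : {i : Fin t} → ¬ King3 T i →
                   Σ (Fin t) λ k → King3 T k × ¬ DistLe T 3 i k × Arc T k i
  dominatingKing {i} not-king with ¬∀⟶∃¬ t (Within T 3 i) (within? 3 i) (λ reach → not-king (within⇒king reach))
  ... | p , p-far with escapingKing p-far
  ... | k , k-far , ki , reach =
    k , within⇒king (λ y → inj₁ (reach y)) , (λ d → k-far (distLe⇒within 3 d)) , ki

  -- A closed walk through i (an arc i → x and a walk back) can be shortcut
  -- to one of length 2 or 3: each later vertex y either returns to i
  -- directly or is dominated by i, which restarts the walk at y.
  closedWalk⇒shortCycle : {i x : Fin t} {l : ℕ} → Arc T i x → Walk T x i l → ShortCycle T i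
  closedWalk⇒shortCycle ix here = ⊥-elim (loopless T _ ix)
  closedWalk⇒shortCycle {i} ix (step {y = y} xy w) with y ≟ i
  ... | yes refl = 1 , s≤s (s≤s z≤n) , step ix (step xy here)
  ... | no y≢i with sc y i y≢i
  ...   | inj₁ yi = 2 , ≤-refl , step ix (step xy (step yi here))
  ...   | inj₂ iy = closedWalk⇒shortCycle iy w

  shortCycle : Strong T → 2 ≤ t → (i : Fin t) → ShortCycle T i
  shortCycle strong 2≤t i with another 2≤t i
  ... | p , p≢i with strong i p
  ...   | _ , here       = ⊥-elim (p≢i refl)
  ...   | _ , step ix _  = closedWalk⇒shortCycle ix (proj₂ (strong _ i))

module Composition-Facts {t : ℕ} {n : Fin t → ℕ}
  (T : Digraph (Fin t)) (H : (i : Fin t) → Digraph (Fin (n i)))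
  (nonempty : (i : Fin t) → 1 ≤ n i) where

  Q : Digraph (CVert t n)
  Q = Composition T H

  pick : (i : Fin t) → Fin (n i)
  pick i = fromℕ< (nonempty i)

  -- Projecting a Q-walk to T drops the inner arcs, so it does not get longer.
  project : {x y : CVert t n} {l : ℕ} → Walk Q x y l → DistLe T l (proj₁ x) (proj₁ y)
  project here = 0 , z≤n , here
  project (step (inner _) w) with project w
  ... | l , l≤ , w′ = l , m≤n⇒m≤1+n l≤ , w′
  project (step (outer a) w) with project w
  ... | l , l≤ , w′ = suc l , s≤s l≤ , step a w′

  projectDistLe : {k : ℕ} {x y : CVert t n} → DistLe Q k x y → DistLe T k (proj₁ x) (proj₁ y)
  projectDistLe (l , l≤k , w) with project w
  ... | l′ , l′≤l , w′ = l′ , ≤-trans l′≤l l≤k , w′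

  strongQuotient : Strong Q → Strong T
  strongQuotient strong i p with projectDistLe (_ , ≤-refl , proj₂ (strong (i , pick i) (p , pick p)))
  ... | l , _ , w = l , w

  liftWalk : {i p : Fin t} {l : ℕ} → Walk T i p (suc l) →
             (a : Fin (n i)) (b : Fin (n p)) → Walk Q (i , a) (p , b) (suc l)
  liftWalk (step ip here)         a b = step (outer ip) here
  liftWalk (step ij (step jk w))  a b = step (outer ij) (liftWalk (step jk w) (pick _) b)

  module Kingship (sc : Semicomplete T) (cycles : (i : Fin t) → ShortCycle T i) where

    -- Distances in T bound distances in Q; length 0 is handled by the short
    -- cycle through the block.
    liftDistLe : {i p : Fin t} → DistLe T 3 i p →
                 (a : Fin (n i)) (b : Fin (n p)) → DistLe Q 3 (i , a) (p , b)
    liftDistLe {i} (zero , _ , here) a b with cycles i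
    ... | l , l≤3 , w = suc l , l≤3 , liftWalk w a b
    liftDistLe (suc l , l≤3 , w) a b = suc l , l≤3 , liftWalk w a b

    kingT⇒kingQ : {i : Fin t} → King3 T i → (a : Fin (n i)) → King3 Q (i , a)
    kingT⇒kingQ {i} ki a (p , b) _ = liftDistLe (reach p) a b
      where
      reach : (p : Fin t) → DistLe T 3 i p
      reach p with p ≟ i
      ... | yes refl = 0 , z≤n , here
      ... | no p≢i   = ki p p≢i

    kingQ⇒kingT : {i : Fin t} {a : Fin (n i)} → King3 Q (i , a) → King3 T i
    kingQ⇒kingT kq q q≢i = projectDistLe (kq (q , pick q) (λ e → q≢i (cong proj₁ e)))

    -- A 3-king and a non-king lie in different blocks, which T joins.
    king-nonking-adjacent : (v u : CVert t n) → King3 Q v → NonKing Q u → Arc Q v u ⊎ Arc Q u v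
    king-nonking-adjacent (i , a) (p , b) kv nku with i ≟ p
    ... | yes refl = ⊥-elim (nku (kingT⇒kingQ (kingQ⇒kingT kv) b))
    ... | no i≢p   = Sum.map outer outer (sc i p i≢p)

    -- A non-king's block is not a 3-king of T; a dominating 3-king of T far
    -- from it yields the required 3-king of Q.
    nonking-dominated : (u : CVert t n) → NonKing Q u →
                        Σ (CVert t n) λ v → King3 Q v × ¬ DistLe Q 3 u v × Arc Q v u
    nonking-dominated (i , b) nku
      with Semicomplete-Facts.dominatingKing T sc (λ ki → nku (kingT⇒kingQ ki b))
    ... | k , kk , k-far , ki =
      (k , pick k) , kingT⇒kingQ kk (pick k) , (λ d → k-far (projectDistLe d)) , outer ki

theorem2p9 : (t : ℕ) → 2 ≤ t → (n : Fin t → ℕ) → (∀ i → 1 ≤ n i) →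
    (T : Digraph (Fin t)) → (H : (i : Fin t) → Digraph (Fin (n i))) →
    Semicomplete T → Strong (Composition T H) →
    ((v u : CVert t n) → King3 (Composition T H) v → NonKing (Composition T H) u →
        Arc (Composition T H) v u ⊎ Arc (Composition T H) u v)
    × ((u : CVert t n) → NonKing (Composition T H) u →
        Σ (CVert t n) λ v → King3 (Composition T H) v
          × ¬ DistLe (Composition T H) 3 u v × Arc (Composition T H) v u)
theorem2p9 t 2≤t n nonempty T H sc strongQ = king-nonking-adjacent , nonking-dominated
  where
  open Composition-Facts T H nonempty
  open Kingship sc (Semicomplete-Facts.shortCycle T sc (strongQuotient strongQ) 2≤t)
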